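{- Let $c\ge1$ be an integer. Then $I_{c,1}=\binom{c}{2}$ and for all $n\ge2$, $$I_{c,n}=c^n n!\,\frac{cn-1}{2}+cn\,I_{c,n-1}.$$
   Context: For integers $n\ge1$, $c\ge1$, let $G_{c,n}$ be the set of colored permutations: words $\sigma=\sigma_1^{[c_1]}\cdots\sigma_n^{[c_n]}$ where $|\sigma|=\sigma_1\cdots\sigma_n$ is a permutation of $[n]$ and each color $c_i\in\{0,\dots,c-1\}$. For a permutation $\pi$ of $[n]$, $\mathrm{inv}(\pi)=|\{(i,j):i<j,\ \pi_i>\pi_j\}|$. Let $\mathrm{col}(\sigma)=c_1+\cdots+c_n$ and $\mathrm{inv}_c(\sigma)=\mathrm{inv}(|\sigma|)+\mathrm{col}(\sigma)+c\cdot|\{(i,j):1\le i<j\le n,\ \sigma_i<\sigma_j,\ c_j\ne0\}|$. Let $I_{c,n}=\sum_{\sigma\in G_{c,n}}\mathrm{inv}_c(\sigma)$ be the total number of colored inversions. -}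

module Defs where

open import Data.Nat using (ℕ; zero; suc; _+_; _*_; _<?_; _≟_)
open import Data.Nat.Properties using (≡-decSetoid)
open import Data.List using (List; []; _∷_; map; concatMap; filter; upTo; length; zip; cartesianProduct)
open import Data.Product using (_×_; _,_)
open import Data.Nat.ListAction using (sum)
open import Relation.Nullary using (does; ¬?)
open import Data.Bool using (Bool; true; false; _∧_; not)
open import Data.List.Relation.Unary.Unique.DecSetoid ≡-decSetoid using (unique?)

words : {A : Set} → List A → ℕ → List (List A)
words as zero    = [] ∷ []
words as (suc n) = concatMap (λ a → map (a ∷_) (words as n)) as

-- permutations of [n] = {1,…,n} in one-line notation:
-- the words of length n over [n] with pairwise distinct letters
perms : ℕ → List (List ℕ)
perms n = filter unique? (words (map suc (upTo n)) n)

count : {A : Set} → (A → Bool) → List A → ℕ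
count p []       = 0
count p (x ∷ xs) = (if p x then 1 else 0) + count p xs
  where
  if_then_else_ : Bool → ℕ → ℕ → ℕ
  if true  then a else b = a
  if false then a else b = b

inv : List ℕ → ℕ
inv []       = 0
inv (x ∷ xs) = count (λ y → does (y <? x)) xs + inv xs

col : List ℕ → ℕ
col cs = sum cs

-- #{(i,j) : i<j, σ_i < σ_j, c_j ≠ 0}, for the list of pairs (σ_i , c_i)
ascNZ : List (ℕ × ℕ) → ℕ
ascNZ []             = 0
ascNZ ((x , _) ∷ xs) =
  count (λ { (y , d) → does (x <? y) ∧ not (does (d ≟ 0)) }) xs + ascNZ xs

-- inv_c(σ) for the colored permutation with underlying permutation π
-- and color word cs
invc : ℕ → List ℕ → List ℕ → ℕ
invc c π cs = inv π + col cs + c * ascNZ (zip π cs)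

-- G_{c,n}: pairs (|σ|, colors), colors ∈ {0,…,c-1}
G : ℕ → ℕ → List (List ℕ × List ℕ)
G c n = cartesianProduct (perms n) (words (upTo c) n)

I : ℕ → ℕ → ℕ
I c n = sum (map (λ { (π , cs) → invc c π cs }) (G c n))

{-# OPTIONS --safe #-}
-- For a fixed permutation π, averaging over the c^n color words gives n(c−1)/2 for col, and each
-- pair i < j with π_i < π_j contributes c · (c−1)/c = c−1 to the last term of inv_c. Averaging then over
-- the n! permutations, each pair of entries is inverted in exactly half of them, so inv and the number
-- of such non-inverted pairs both sum to n! C(n,2)/2. Hence 2 I_{c,n} = c^n n! (c C(n,2) + n(c−1)),
-- and the recurrence is an identity between these closed forms at n and n − 1. All sums over words
-- and over words without repeated letters are computed by splitting off the first letter.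

module Submission where

open import Defs

open import Data.Bool.Base using (Bool; true; false; _∧_; not)
open import Data.List.Base using (List; []; _∷_; _++_; map; concatMap; filter; upTo; applyUpTo; length; zip; cartesianProduct)
open import Data.List.Membership.Propositional using (_∈_)
open import Data.List.Properties
  using (map-++; map-cong; map-cong-local; map-∘; map-id; filter-all; filter-accept; filter-reject; length-map; length-upTo; upTo-∷ʳ)
open import Data.List.Relation.Unary.All as All using (all?)
open import Data.List.Relation.Unary.AllPairs using ([]; _∷_)
open import Data.List.Relation.Unary.Any using (here; there)
open import Data.List.Relation.Unary.Unique.Propositional using (Unique)
import Data.List.Relation.Unary.Unique.Propositional.Properties as Unique
open import Data.Nat.Base
open import Data.Nat.Combinatorics using (_C_; nC1≡n; nCk+nC[k+1]≡[n+1]C[k+1])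
open import Data.Nat.ListAction using (sum)
open import Data.Nat.ListAction.Properties using (sum-++)
open import Data.Nat.Properties
open import Data.Nat.Tactic.RingSolver using (solve-∀)
open import Data.Product.Base using (_×_; _,_)
open import Function.Base using (_∘_)
open import Relation.Binary.Definitions using (tri<; tri≈; tri>)
open import Relation.Binary.PropositionalEquality
open import Relation.Nullary.Decidable using (does; ¬?; dec-true; dec-false)
open import Relation.Nullary.Negation using (contradiction)
open import Relation.Unary using (Decidable)

open import Data.List.Relation.Unary.Unique.DecSetoid ≡-decSetoid using (unique?)
open import Algebra.Properties.CommutativeSemigroup +-commutativeSemigroup using ()
  renaming (interchange to +-interchange; x∙yz≈y∙xz to +-left-comm)
open import Algebra.Properties.CommutativeSemigroup *-commutativeSemigroup using ()
  renaming (x∙yz≈y∙xz to *-left-comm)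

open ≡-Reasoning

private variable
  A B : Set

-- Sums over lists

⟦_⟧ : Bool → ℕ
⟦ true ⟧ = 1
⟦ false ⟧ = 0

∑ : (A → ℕ) → List A → ℕ
∑ f xs = sum (map f xs)

∑-cong : {f g : A → ℕ} → (∀ x → f x ≡ g x) → ∀ xs → ∑ f xs ≡ ∑ g xs
∑-cong f≗g xs = cong sum (map-cong f≗g xs)

∑-cong-∈ : {f g : A → ℕ} {xs : List A} → (∀ {x} → x ∈ xs → f x ≡ g x) → ∑ f xs ≡ ∑ g xs
∑-cong-∈ f≗g = cong sum (map-cong-local (All.tabulate f≗g))

∑-++ : ∀ (f : A → ℕ) xs ys → ∑ f (xs ++ ys) ≡ ∑ f xs + ∑ f ys
∑-++ f xs ys = trans (cong sum (map-++ f xs ys)) (sum-++ (map f xs) (map f ys))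

∑-map : ∀ (f : B → ℕ) (g : A → B) xs → ∑ f (map g xs) ≡ ∑ (f ∘ g) xs
∑-map f g xs = cong sum (sym (map-∘ xs))

∑-+ : ∀ (f g : A → ℕ) xs → ∑ (λ x → f x + g x) xs ≡ ∑ f xs + ∑ g xs
∑-+ f g []       = refl
∑-+ f g (x ∷ xs) = trans (cong (f x + g x +_) (∑-+ f g xs)) (+-interchange (f x) (g x) (∑ f xs) (∑ g xs))

∑-*ˡ : ∀ k (f : A → ℕ) xs → ∑ (λ x → k * f x) xs ≡ k * ∑ f xs
∑-*ˡ k f []       = sym (*-zeroʳ k)
∑-*ˡ k f (x ∷ xs) = trans (cong (k * f x +_) (∑-*ˡ k f xs)) (sym (*-distribˡ-+ k (f x) _))

∑-const : ∀ k (xs : List A) → ∑ (λ _ → k) xs ≡ length xs * k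
∑-const k []       = refl
∑-const k (x ∷ xs) = cong (k +_) (∑-const k xs)

∑-length : ∀ (xs : List A) → ∑ (λ _ → 1) xs ≡ length xs
∑-length xs = trans (∑-const 1 xs) (*-identityʳ (length xs))

∑-const-∈ : ∀ {f : A → ℕ} {k n xs} → length xs ≡ n → (∀ {x} → x ∈ xs → f x ≡ k) → ∑ f xs ≡ n * k
∑-const-∈ {k = k} {xs = xs} refl f≡k = trans (∑-cong-∈ f≡k) (∑-const k xs)

∑-concatMap : ∀ (f : B → ℕ) (g : A → List B) xs → ∑ f (concatMap g xs) ≡ ∑ (λ x → ∑ f (g x)) xs
∑-concatMap f g []       = refl
∑-concatMap f g (x ∷ xs) = trans (∑-++ f (g x) (concatMap g xs)) (cong (∑ f (g x) +_) (∑-concatMap f g xs))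

∑-swap : ∀ (f : A → B → ℕ) xs ys → ∑ (λ x → ∑ (f x) ys) xs ≡ ∑ (λ y → ∑ (λ x → f x y) xs) ys
∑-swap f []       ys = sym (trans (∑-const 0 ys) (*-zeroʳ (length ys)))
∑-swap f (x ∷ xs) ys = trans (cong (∑ (f x) ys +_) (∑-swap f xs ys)) (sym (∑-+ (f x) _ ys))

∑-cartesianProduct : ∀ (f : A × B → ℕ) xs ys →
  ∑ f (cartesianProduct xs ys) ≡ ∑ (λ x → ∑ (λ y → f (x , y)) ys) xs
∑-cartesianProduct f []       ys = refl
∑-cartesianProduct f (x ∷ xs) ys = begin
  ∑ f (map (x ,_) ys ++ cartesianProduct xs ys)       ≡⟨ ∑-++ f (map (x ,_) ys) _ ⟩
  ∑ f (map (x ,_) ys) + ∑ f (cartesianProduct xs ys) ≡⟨ cong₂ _+_ (∑-map f (x ,_) ys) (∑-cartesianProduct f xs ys) ⟩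
  ∑ (λ y → f (x , y)) ys + ∑ (λ x → ∑ (λ y → f (x , y)) ys) xs ∎

∑-filter : ∀ (f : A → ℕ) {P : A → Set} (P? : Decidable P) xs →
  ∑ f (filter P? xs) ≡ ∑ (λ x → ⟦ does (P? x) ⟧ * f x) xs
∑-filter f P? []       = refl
∑-filter f P? (x ∷ xs) with does (P? x)
... | true  = cong₂ _+_ (sym (+-identityʳ (f x))) (∑-filter f P? xs)
... | false = ∑-filter f P? xs

count≡∑ : ∀ (p : A → Bool) xs → count p xs ≡ ∑ (λ x → ⟦ p x ⟧) xs
count≡∑ p []       = refl
count≡∑ p (x ∷ xs) with p x
... | true  = cong suc (count≡∑ p xs)
... | false = count≡∑ p xs

count-∷ : ∀ (p : A → Bool) x xs → count p (x ∷ xs) ≡ ⟦ p x ⟧ + count p xs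
count-∷ p x xs with p x
... | true  = refl
... | false = refl

⟦∧⟧* : ∀ b c n → ⟦ b ∧ c ⟧ * n ≡ ⟦ b ⟧ * (⟦ c ⟧ * n)
⟦∧⟧* true  c n = sym (*-identityˡ (⟦ c ⟧ * n))
⟦∧⟧* false c n = refl

∑-⟦∧⟧ : ∀ b (r : A → Bool) xs → ∑ (λ x → ⟦ b ∧ r x ⟧) xs ≡ ⟦ b ⟧ * count r xs
∑-⟦∧⟧ true  r xs = trans (sym (count≡∑ r xs)) (sym (*-identityˡ (count r xs)))
∑-⟦∧⟧ false r xs = trans (∑-const 0 xs) (*-zeroʳ (length xs))

-- Related pairs and inversions

relatedPairs : (A → A → Bool) → List A → ℕ
relatedPairs R xs = ∑ (λ x → count (R x) xs) xs

relatedPairs-transpose : ∀ (R : A → A → Bool) xs → ∑ (λ x → count (λ y → R y x) xs) xs ≡ relatedPairs R xs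
relatedPairs-transpose R xs = begin
  ∑ (λ x → count (λ y → R y x) xs) xs      ≡⟨ ∑-cong (λ x → count≡∑ (λ y → R y x) xs) xs ⟩
  ∑ (λ x → ∑ (λ y → ⟦ R y x ⟧) xs) xs      ≡⟨ ∑-swap (λ x y → ⟦ R y x ⟧) xs xs ⟩
  ∑ (λ y → ∑ (λ x → ⟦ R y x ⟧) xs) xs      ≡⟨ ∑-cong (λ y → count≡∑ (R y) xs) xs ⟨
  relatedPairs R xs                        ∎

relatedPairs-tournament : ∀ (R : A → A → Bool) → (∀ x → R x x ≡ false) →
  (∀ {x y} → x ≢ y → ⟦ R x y ⟧ + ⟦ R y x ⟧ ≡ 1) → ∀ {xs} → Unique xs → relatedPairs R xs ≡ length xs C 2
relatedPairs-tournament R irrefl tournament {[]}     []          = refl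
relatedPairs-tournament R irrefl tournament {x ∷ xs} (x∉xs ∷ u) = begin
  count (R x) (x ∷ xs) + ∑ (λ y → count (R y) (x ∷ xs)) xs
    ≡⟨ cong₂ _+_ (count-∷ (R x) x xs) (∑-cong (λ y → count-∷ (R y) x xs) xs) ⟩
  ⟦ R x x ⟧ + count (R x) xs + ∑ (λ y → ⟦ R y x ⟧ + count (R y) xs) xs
    ≡⟨ cong₂ (λ b s → ⟦ b ⟧ + count (R x) xs + s) (irrefl x) (∑-+ _ _ xs) ⟩
  count (R x) xs + (∑ (λ y → ⟦ R y x ⟧) xs + relatedPairs R xs)
    ≡⟨ +-assoc (count (R x) xs) _ _ ⟨
  count (R x) xs + ∑ (λ y → ⟦ R y x ⟧) xs + relatedPairs R xs
    ≡⟨ cong₂ _+_ pairs-with-x (relatedPairs-tournament R irrefl tournament u) ⟩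
  length xs + length xs C 2
    ≡⟨ cong (_+ length xs C 2) (nC1≡n (length xs)) ⟨
  length xs C 1 + length xs C 2
    ≡⟨ nCk+nC[k+1]≡[n+1]C[k+1] (length xs) 1 ⟩
  suc (length xs) C 2 ∎
  where
  pairs-with-x : count (R x) xs + ∑ (λ y → ⟦ R y x ⟧) xs ≡ length xs
  pairs-with-x = begin
    count (R x) xs + ∑ (λ y → ⟦ R y x ⟧) xs           ≡⟨ cong (_+ ∑ (λ y → ⟦ R y x ⟧) xs) (count≡∑ (R x) xs) ⟩
    ∑ (λ y → ⟦ R x y ⟧) xs + ∑ (λ y → ⟦ R y x ⟧) xs   ≡⟨ ∑-+ _ _ xs ⟨
    ∑ (λ y → ⟦ R x y ⟧ + ⟦ R y x ⟧) xs                ≡⟨ ∑-cong-∈ (λ y∈xs → tournament (All.lookup x∉xs y∈xs)) ⟩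
    ∑ (λ _ → 1) xs                                   ≡⟨ ∑-length xs ⟩
    length xs                                        ∎

inversionsBy : (A → A → Bool) → List A → ℕ
inversionsBy R []       = 0
inversionsBy R (x ∷ xs) = count (R x) xs + inversionsBy R xs

coinv : List ℕ → ℕ
coinv = inversionsBy _<ᵇ_

<ᵇ-irrefl : ∀ x → (x <ᵇ x) ≡ false
<ᵇ-irrefl x = dec-false (x <? x) (<-irrefl refl)

<ᵇ-tournament : ∀ {x y} → x ≢ y → ⟦ x <ᵇ y ⟧ + ⟦ y <ᵇ x ⟧ ≡ 1
<ᵇ-tournament {x} {y} x≢y with <-cmp x y
... | tri< x<y _ y≮x = cong₂ (λ a b → ⟦ a ⟧ + ⟦ b ⟧) (dec-true (x <? y) x<y) (dec-false (y <? x) y≮x)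
... | tri≈ _ x≡y _   = contradiction x≡y x≢y
... | tri> x≮y _ y<x = cong₂ (λ a b → ⟦ a ⟧ + ⟦ b ⟧) (dec-false (x <? y) x≮y) (dec-true (y <? x) y<x)

[1+n]C2≡n+nC2 : ∀ n → suc n C 2 ≡ n + n C 2
[1+n]C2≡n+nC2 n = trans (sym (nCk+nC[k+1]≡[n+1]C[k+1] n 1)) (cong (_+ n C 2) (nC1≡n n))

2*[1+n]C2≡[1+n]*n : ∀ n → 2 * (suc n C 2) ≡ suc n * n
2*[1+n]C2≡[1+n]*n zero    = refl
2*[1+n]C2≡[1+n]*n (suc n) = begin
  2 * (suc (suc n) C 2)         ≡⟨ cong (2 *_) ([1+n]C2≡n+nC2 (suc n)) ⟩
  2 * (suc n + suc n C 2)       ≡⟨ *-distribˡ-+ 2 (suc n) _ ⟩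
  2 * suc n + 2 * (suc n C 2)   ≡⟨ cong (2 * suc n +_) (2*[1+n]C2≡[1+n]*n n) ⟩
  2 * suc n + suc n * n         ≡⟨ collect n ⟩
  suc (suc n) * suc n           ∎
  where
  collect : ∀ n → 2 * suc n + suc n * n ≡ suc (suc n) * suc n
  collect = solve-∀

sum-upTo : ∀ n → sum (upTo n) ≡ n C 2
sum-upTo zero    = refl
sum-upTo (suc n) = begin
  sum (upTo (suc n))          ≡⟨ cong sum (upTo-∷ʳ n) ⟨
  sum (upTo n ++ n ∷ [])      ≡⟨ sum-++ (upTo n) (n ∷ []) ⟩
  sum (upTo n) + (n + 0)      ≡⟨ cong₂ _+_ (sum-upTo n) (+-identityʳ n) ⟩
  n C 2 + n                   ≡⟨ +-comm (n C 2) n ⟩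
  n + n C 2                   ≡⟨ [1+n]C2≡n+nC2 n ⟨
  suc n C 2                   ∎

-- Words

∑-words-suc : ∀ (f : List A → ℕ) xs n →
  ∑ f (words xs (suc n)) ≡ ∑ (λ x → ∑ (λ w → f (x ∷ w)) (words xs n)) xs
∑-words-suc f xs n = trans (∑-concatMap f _ xs) (∑-cong (λ x → ∑-map f (x ∷_) (words xs n)) xs)

∑-words-cong : ∀ {f g : List A → ℕ} xs n → (∀ w → length w ≡ n → f w ≡ g w) → ∑ f (words xs n) ≡ ∑ g (words xs n)
∑-words-cong     xs zero    f≗g = cong (_+ 0) (f≗g [] refl)
∑-words-cong {f = f} {g} xs (suc n) f≗g = begin
  ∑ f (words xs (suc n))                               ≡⟨ ∑-words-suc f xs n ⟩
  ∑ (λ x → ∑ (λ w → f (x ∷ w)) (words xs n)) xs        ≡⟨ ∑-cong (λ x → ∑-words-cong xs n (λ w ∣w∣≡n → f≗g (x ∷ w) (cong suc ∣w∣≡n))) xs ⟩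
  ∑ (λ x → ∑ (λ w → g (x ∷ w)) (words xs n)) xs        ≡⟨ ∑-words-suc g xs n ⟨
  ∑ g (words xs (suc n))                               ∎

∑-words-const : ∀ k (xs : List A) n → ∑ (λ _ → k) (words xs n) ≡ length xs ^ n * k
∑-words-const k xs zero    = refl
∑-words-const k xs (suc n) = begin
  ∑ (λ _ → k) (words xs (suc n))                  ≡⟨ ∑-words-suc (λ _ → k) xs n ⟩
  ∑ (λ _ → ∑ (λ _ → k) (words xs n)) xs           ≡⟨ ∑-const _ xs ⟩
  length xs * ∑ (λ _ → k) (words xs n)            ≡⟨ cong (length xs *_) (∑-words-const k xs n) ⟩
  length xs * (length xs ^ n * k)                 ≡⟨ *-assoc (length xs) _ k ⟨
  length xs ^ suc n * k                           ∎

∑-words-split : ∀ (h : A → ℕ) (g : List A → ℕ) xs n →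
  ∑ (λ x → ∑ (λ w → h x + g w) (words xs n)) xs ≡ length xs ^ n * ∑ h xs + length xs * ∑ g (words xs n)
∑-words-split h g xs n = begin
  ∑ (λ x → ∑ (λ w → h x + g w) (words xs n)) xs  ≡⟨ ∑-cong (λ x → ∑-+ (λ _ → h x) g (words xs n)) xs ⟩
  ∑ (λ x → ∑ (λ _ → h x) (words xs n) + T) xs    ≡⟨ ∑-cong (λ x → cong (_+ T) (∑-words-const (h x) xs n)) xs ⟩
  ∑ (λ x → length xs ^ n * h x + T) xs           ≡⟨ ∑-+ _ _ xs ⟩
  ∑ (λ x → length xs ^ n * h x) xs + ∑ (λ _ → T) xs ≡⟨ cong₂ _+_ (∑-*ˡ (length xs ^ n) h xs) (∑-const T xs) ⟩
  length xs ^ n * ∑ h xs + length xs * T         ∎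
  where T = ∑ g (words xs n)

first-letter-step : ∀ L x a b t → t * L ≡ b * x → (x * a + L * t) * L ≡ (a + b) * (L * x)
first-letter-step L x a b t tL≡bx = begin
  (x * a + L * t) * L     ≡⟨ distrib L x a t ⟩
  x * a * L + L * (t * L) ≡⟨ cong (λ u → x * a * L + L * u) tL≡bx ⟩
  x * a * L + L * (b * x) ≡⟨ collect L x a b ⟩
  (a + b) * (L * x)       ∎
  where
  distrib : ∀ L x a t → (x * a + L * t) * L ≡ x * a * L + L * (t * L)
  distrib = solve-∀
  collect : ∀ L x a b → x * a * L + L * (b * x) ≡ (a + b) * (L * x)
  collect = solve-∀

-- Sums over words of length n are multiplied by length xs, so that the exponent n ∸ 1 never appears.
∑-col-words : ∀ xs n → ∑ col (words xs n) * length xs ≡ n * sum xs * length xs ^ n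
∑-col-words xs zero    = refl
∑-col-words xs (suc n) = begin
  ∑ col (words xs (suc n)) * L                     ≡⟨ cong (_* L) (∑-words-suc col xs n) ⟩
  ∑ (λ x → ∑ (λ w → x + col w) (words xs n)) xs * L ≡⟨ cong (_* L) (∑-words-split (λ x → x) col xs n) ⟩
  (L ^ n * ∑ (λ x → x) xs + L * ∑ col (words xs n)) * L
    ≡⟨ cong (λ s → (L ^ n * s + L * ∑ col (words xs n)) * L) (cong sum (map-id xs)) ⟩
  (L ^ n * sum xs + L * ∑ col (words xs n)) * L    ≡⟨ first-letter-step L (L ^ n) (sum xs) _ _ (∑-col-words xs n) ⟩
  suc n * sum xs * L ^ suc n                       ∎
  where L = length xs

∑-count-zip-words : ∀ (P : A × B → Bool) (q : A → Bool) (r : B → Bool) → (∀ y x → P (y , x) ≡ q y ∧ r x) →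
  ∀ xs π → ∑ (λ w → count P (zip π w)) (words xs (length π)) * length xs ≡ count q π * count r xs * length xs ^ length π
∑-count-zip-words P q r P≡q∧r xs []      = refl
∑-count-zip-words P q r P≡q∧r xs (y ∷ π) = begin
  ∑ (λ w → count P (zip (y ∷ π) w)) (words xs (suc m)) * L
    ≡⟨ cong (_* L) (∑-words-suc _ xs m) ⟩
  ∑ (λ x → ∑ (λ w → count P ((y , x) ∷ zip π w)) (words xs m)) xs * L
    ≡⟨ cong (_* L) (∑-cong (λ x → ∑-cong (λ w → count-∷ P (y , x) (zip π w)) (words xs m)) xs) ⟩
  ∑ (λ x → ∑ (λ w → ⟦ P (y , x) ⟧ + count P (zip π w)) (words xs m)) xs * L
    ≡⟨ cong (_* L) (∑-words-split (λ x → ⟦ P (y , x) ⟧) _ xs m) ⟩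
  (L ^ m * ∑ (λ x → ⟦ P (y , x) ⟧) xs + L * T) * L
    ≡⟨ cong (λ s → (L ^ m * s + L * T) * L) (trans (∑-cong (λ x → cong ⟦_⟧ (P≡q∧r y x)) xs) (∑-⟦∧⟧ (q y) r xs)) ⟩
  (L ^ m * (⟦ q y ⟧ * R) + L * T) * L
    ≡⟨ first-letter-step L (L ^ m) _ _ T (∑-count-zip-words P q r P≡q∧r xs π) ⟩
  (⟦ q y ⟧ * R + count q π * R) * L ^ suc m
    ≡⟨ cong (_* L ^ suc m) (trans (sym (*-distribʳ-+ R ⟦ q y ⟧ (count q π))) (cong (_* R) (sym (count-∷ q y π)))) ⟩
  count q (y ∷ π) * R * L ^ suc m ∎
  where
  m = length π
  L = length xs
  R = count r xs
  T = ∑ (λ w → count P (zip π w)) (words xs m)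

nonZeroᵇ : ℕ → Bool
nonZeroᵇ e = not (e ≡ᵇ 0)

∑-ascNZ-words : ∀ xs π → ∑ (λ w → ascNZ (zip π w)) (words xs (length π)) * length xs
                         ≡ coinv π * count nonZeroᵇ xs * length xs ^ length π
∑-ascNZ-words xs []      = refl
∑-ascNZ-words xs (y ∷ π) = begin
  ∑ (λ w → ascNZ (zip (y ∷ π) w)) (words xs (suc m)) * L
    ≡⟨ cong (_* L) (∑-words-suc _ xs m) ⟩
  ∑ (λ _ → ∑ (λ w → count P (zip π w) + ascNZ (zip π w)) (words xs m)) xs * L
    ≡⟨ cong (_* L) (∑-const _ xs) ⟩
  L * ∑ (λ w → count P (zip π w) + ascNZ (zip π w)) (words xs m) * L
    ≡⟨ cong (λ s → L * s * L) (∑-+ _ _ (words xs m)) ⟩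
  L * (Tₚ + Tₐ) * L
    ≡⟨ distrib L Tₚ Tₐ ⟩
  L * (Tₚ * L + Tₐ * L)
    ≡⟨ cong (L *_) (cong₂ _+_ (∑-count-zip-words P (y <ᵇ_) nonZeroᵇ (λ _ _ → refl) xs π) (∑-ascNZ-words xs π)) ⟩
  L * (count (y <ᵇ_) π * N * L ^ m + coinv π * N * L ^ m)
    ≡⟨ collect L (L ^ m) N (count (y <ᵇ_) π) (coinv π) ⟩
  coinv (y ∷ π) * N * L ^ suc m ∎
  where
  m = length π
  L = length xs
  N = count nonZeroᵇ xs
  P : ℕ × ℕ → Bool
  P (z , e) = (y <ᵇ z) ∧ nonZeroᵇ e
  Tₚ = ∑ (λ w → count P (zip π w)) (words xs m)
  Tₐ = ∑ (λ w → ascNZ (zip π w)) (words xs m)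
  distrib : ∀ L a b → L * (a + b) * L ≡ L * (a * L + b * L)
  distrib = solve-∀
  collect : ∀ L x N a b → L * (a * N * x + b * N * x) ≡ (a + b) * N * (L * x)
  collect = solve-∀

-- Arrangements

_∖_ : List ℕ → ℕ → List ℕ
xs ∖ x = filter (λ y → ¬? (x ≟ y)) xs

freshᵇ : ℕ → List ℕ → Bool
freshᵇ x w = does (all? (λ y → ¬? (x ≟ y)) w)

∑-∖ : ∀ (f : ℕ → ℕ) {x xs} → Unique xs → x ∈ xs → ∑ f xs ≡ f x + ∑ f (xs ∖ x)
∑-∖ f {xs = y ∷ xs} (y∉xs ∷ _) (here refl) =
  cong (f y +_) (cong (∑ f) (sym (trans (filter-reject (λ z → ¬? (y ≟ z)) (λ y≢y → y≢y refl)) (filter-all (λ z → ¬? (y ≟ z)) y∉xs))))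
∑-∖ f {x} {y ∷ xs} (y∉xs ∷ u) (there x∈xs) = begin
  f y + ∑ f xs                ≡⟨ cong (f y +_) (∑-∖ f u x∈xs) ⟩
  f y + (f x + ∑ f (xs ∖ x))  ≡⟨ +-left-comm (f y) (f x) _ ⟩
  f x + (f y + ∑ f (xs ∖ x))  ≡⟨ cong (λ ys → f x + ∑ f ys) (filter-accept (λ y → ¬? (x ≟ y)) x≢y) ⟨
  f x + ∑ f ((y ∷ xs) ∖ x)    ∎
  where
  x≢y : x ≢ y
  x≢y x≡y = All.lookup y∉xs x∈xs (sym x≡y)

count-∖ : ∀ (p : ℕ → Bool) {x xs} → Unique xs → x ∈ xs → count p xs ≡ ⟦ p x ⟧ + count p (xs ∖ x)
count-∖ p {x} {xs} u x∈xs = begin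
  count p xs                            ≡⟨ count≡∑ p xs ⟩
  ∑ (λ y → ⟦ p y ⟧) xs                  ≡⟨ ∑-∖ (λ y → ⟦ p y ⟧) u x∈xs ⟩
  ⟦ p x ⟧ + ∑ (λ y → ⟦ p y ⟧) (xs ∖ x)  ≡⟨ cong (⟦ p x ⟧ +_) (count≡∑ p (xs ∖ x)) ⟨
  ⟦ p x ⟧ + count p (xs ∖ x)            ∎

count-∖-reject : ∀ (p : ℕ → Bool) {x xs} → p x ≡ false → Unique xs → x ∈ xs → count p xs ≡ count p (xs ∖ x)
count-∖-reject p {x} {xs} px≡false u x∈xs = trans (count-∖ p u x∈xs) (cong (λ b → ⟦ b ⟧ + count p (xs ∖ x)) px≡false)

length-∖ : ∀ {x xs m} → Unique xs → x ∈ xs → length xs ≡ suc m → length (xs ∖ x) ≡ m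
length-∖ {x} {xs} u x∈xs ∣xs∣≡1+m = suc-injective (begin
  suc (length (xs ∖ x))          ≡⟨ cong suc (∑-length (xs ∖ x)) ⟨
  suc (∑ (λ _ → 1) (xs ∖ x))     ≡⟨ ∑-∖ (λ _ → 1) u x∈xs ⟨
  ∑ (λ _ → 1) xs                 ≡⟨ ∑-length xs ⟩
  length xs                      ≡⟨ ∣xs∣≡1+m ⟩
  suc _                          ∎)

Unique-∖ : ∀ {x xs} → Unique xs → Unique (xs ∖ x)
Unique-∖ {x} = Unique.filter⁺ (λ y → ¬? (x ≟ y))

∑-words-fresh : ∀ (f : List ℕ → ℕ) x xs n →
  ∑ (λ w → ⟦ freshᵇ x w ⟧ * f w) (words xs n) ≡ ∑ f (words (xs ∖ x) n)
∑-words-fresh f x xs zero    = cong (_+ 0) (*-identityˡ (f []))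
∑-words-fresh f x xs (suc n) = begin
  ∑ (λ w → ⟦ freshᵇ x w ⟧ * f w) (words xs (suc n))
    ≡⟨ ∑-words-suc _ xs n ⟩
  ∑ (λ y → ∑ (λ w → ⟦ not (x ≡ᵇ y) ∧ freshᵇ x w ⟧ * f (y ∷ w)) (words xs n)) xs
    ≡⟨ ∑-cong (λ y → ∑-cong (λ w → ⟦∧⟧* (not (x ≡ᵇ y)) (freshᵇ x w) (f (y ∷ w))) (words xs n)) xs ⟩
  ∑ (λ y → ∑ (λ w → ⟦ not (x ≡ᵇ y) ⟧ * (⟦ freshᵇ x w ⟧ * f (y ∷ w))) (words xs n)) xs
    ≡⟨ ∑-cong (λ y → ∑-*ˡ ⟦ not (x ≡ᵇ y) ⟧ _ (words xs n)) xs ⟩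
  ∑ (λ y → ⟦ not (x ≡ᵇ y) ⟧ * ∑ (λ w → ⟦ freshᵇ x w ⟧ * f (y ∷ w)) (words xs n)) xs
    ≡⟨ ∑-cong (λ y → cong (⟦ not (x ≡ᵇ y) ⟧ *_) (∑-words-fresh (λ w → f (y ∷ w)) x xs n)) xs ⟩
  ∑ (λ y → ⟦ not (x ≡ᵇ y) ⟧ * ∑ (λ w → f (y ∷ w)) (words (xs ∖ x) n)) xs
    ≡⟨ ∑-filter _ (λ y → ¬? (x ≟ y)) xs ⟨
  ∑ (λ y → ∑ (λ w → f (y ∷ w)) (words (xs ∖ x) n)) (xs ∖ x)
    ≡⟨ ∑-words-suc f (xs ∖ x) n ⟨
  ∑ f (words (xs ∖ x) (suc n)) ∎

arrangements : List ℕ → ℕ → List (List ℕ)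
arrangements xs n = filter unique? (words xs n)

-- does (unique? (x ∷ w)) computes to freshᵇ x w ∧ does (unique? w).
∑-arrangements-suc : ∀ (f : List ℕ → ℕ) xs n →
  ∑ f (arrangements xs (suc n)) ≡ ∑ (λ x → ∑ (λ w → f (x ∷ w)) (arrangements (xs ∖ x) n)) xs
∑-arrangements-suc f xs n = begin
  ∑ f (arrangements xs (suc n))
    ≡⟨ ∑-filter f unique? (words xs (suc n)) ⟩
  ∑ (λ w → ⟦ does (unique? w) ⟧ * f w) (words xs (suc n))
    ≡⟨ ∑-words-suc _ xs n ⟩
  ∑ (λ x → ∑ (λ w → ⟦ freshᵇ x w ∧ does (unique? w) ⟧ * f (x ∷ w)) (words xs n)) xs
    ≡⟨ ∑-cong (λ x → ∑-cong (λ w → ⟦∧⟧* (freshᵇ x w) _ _) (words xs n)) xs ⟩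
  ∑ (λ x → ∑ (λ w → ⟦ freshᵇ x w ⟧ * (⟦ does (unique? w) ⟧ * f (x ∷ w))) (words xs n)) xs
    ≡⟨ ∑-cong (λ x → ∑-words-fresh (λ w → ⟦ does (unique? w) ⟧ * f (x ∷ w)) x xs n) xs ⟩
  ∑ (λ x → ∑ (λ w → ⟦ does (unique? w) ⟧ * f (x ∷ w)) (words (xs ∖ x) n)) xs
    ≡⟨ ∑-cong (λ x → ∑-filter (λ w → f (x ∷ w)) unique? (words (xs ∖ x) n)) xs ⟨
  ∑ (λ x → ∑ (λ w → f (x ∷ w)) (arrangements (xs ∖ x) n)) xs ∎

∑-arrangements-cong : ∀ {f g : List ℕ → ℕ} xs n → (∀ w → length w ≡ n → f w ≡ g w) →
  ∑ f (arrangements xs n) ≡ ∑ g (arrangements xs n)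
∑-arrangements-cong {f} {g} xs n f≗g = begin
  ∑ f (arrangements xs n)                              ≡⟨ ∑-filter f unique? (words xs n) ⟩
  ∑ (λ w → ⟦ does (unique? w) ⟧ * f w) (words xs n)    ≡⟨ ∑-words-cong xs n (λ w ∣w∣≡n → cong (⟦ does (unique? w) ⟧ *_) (f≗g w ∣w∣≡n)) ⟩
  ∑ (λ w → ⟦ does (unique? w) ⟧ * g w) (words xs n)    ≡⟨ ∑-filter g unique? (words xs n) ⟨
  ∑ g (arrangements xs n)                              ∎

∑-arrangements-const : ∀ k {xs} m → Unique xs → length xs ≡ m → ∑ (λ _ → k) (arrangements xs m) ≡ m ! * k
∑-arrangements-const k {[]} zero    _ _   = refl
∑-arrangements-const k {xs} (suc m) u len = begin
  ∑ (λ _ → k) (arrangements xs (suc m))               ≡⟨ ∑-arrangements-suc _ xs m ⟩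
  ∑ (λ x → ∑ (λ _ → k) (arrangements (xs ∖ x) m)) xs  ≡⟨ ∑-const-∈ len (λ x∈xs → ∑-arrangements-const k m (Unique-∖ u) (length-∖ u x∈xs len)) ⟩
  suc m * (m ! * k)                                   ≡⟨ *-assoc (suc m) (m !) k ⟨
  suc m ! * k                                         ∎

∑-arrangements-count : ∀ (p : ℕ → Bool) {xs} m → Unique xs → length xs ≡ m →
  ∑ (count p) (arrangements xs m) ≡ m ! * count p xs
∑-arrangements-count p {[]} zero    _ _   = refl
∑-arrangements-count p {xs} (suc m) u len = begin
  ∑ (count p) (arrangements xs (suc m))                              ≡⟨ ∑-arrangements-suc _ xs m ⟩
  ∑ (λ x → ∑ (λ w → count p (x ∷ w)) (arrangements (xs ∖ x) m)) xs   ≡⟨ ∑-const-∈ len first-letter ⟩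
  suc m * (m ! * count p xs)                                         ≡⟨ *-assoc (suc m) (m !) _ ⟨
  suc m ! * count p xs                                               ∎
  where
  first-letter : ∀ {x} → x ∈ xs → ∑ (λ w → count p (x ∷ w)) (arrangements (xs ∖ x) m) ≡ m ! * count p xs
  first-letter {x} x∈xs = begin
    ∑ (λ w → count p (x ∷ w)) ws                ≡⟨ ∑-cong (count-∷ p x) ws ⟩
    ∑ (λ w → ⟦ p x ⟧ + count p w) ws            ≡⟨ ∑-+ _ _ ws ⟩
    ∑ (λ _ → ⟦ p x ⟧) ws + ∑ (count p) ws       ≡⟨ cong₂ _+_ (∑-arrangements-const _ m u′ len′) (∑-arrangements-count p m u′ len′) ⟩
    m ! * ⟦ p x ⟧ + m ! * count p (xs ∖ x)      ≡⟨ *-distribˡ-+ (m !) _ _ ⟨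
    m ! * (⟦ p x ⟧ + count p (xs ∖ x))          ≡⟨ cong (m ! *_) (count-∖ p u x∈xs) ⟨
    m ! * count p xs                            ∎
    where
    ws = arrangements (xs ∖ x) m
    u′ = Unique-∖ u
    len′ = length-∖ u x∈xs len

relatedPairs-∖ : ∀ R → (∀ x → R x x ≡ false) → ∀ {x xs} → Unique xs → x ∈ xs →
  relatedPairs R xs ≡ count (R x) xs + count (λ y → R y x) xs + relatedPairs R (xs ∖ x)
relatedPairs-∖ R irrefl {x} {xs} u x∈xs = begin
  relatedPairs R xs
    ≡⟨ ∑-∖ (λ y → count (R y) xs) u x∈xs ⟩
  count (R x) xs + ∑ (λ y → count (R y) xs) (xs ∖ x)
    ≡⟨ cong (count (R x) xs +_) (∑-cong (λ y → count-∖ (R y) u x∈xs) (xs ∖ x)) ⟩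
  count (R x) xs + ∑ (λ y → ⟦ R y x ⟧ + count (R y) (xs ∖ x)) (xs ∖ x)
    ≡⟨ cong (count (R x) xs +_) (∑-+ _ _ (xs ∖ x)) ⟩
  count (R x) xs + (∑ (λ y → ⟦ R y x ⟧) (xs ∖ x) + relatedPairs R (xs ∖ x))
    ≡⟨ cong (λ s → count (R x) xs + (s + relatedPairs R (xs ∖ x))) (count≡∑ (λ y → R y x) (xs ∖ x)) ⟨
  count (R x) xs + (count (λ y → R y x) (xs ∖ x) + relatedPairs R (xs ∖ x))
    ≡⟨ cong (λ s → count (R x) xs + (s + relatedPairs R (xs ∖ x))) (count-∖-reject (λ y → R y x) (irrefl x) u x∈xs) ⟨
  count (R x) xs + (count (λ y → R y x) xs + relatedPairs R (xs ∖ x))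
    ≡⟨ +-assoc (count (R x) xs) _ _ ⟨
  count (R x) xs + count (λ y → R y x) xs + relatedPairs R (xs ∖ x) ∎

∑-relatedPairs-∖ : ∀ R → (∀ x → R x x ≡ false) → ∀ {xs} → Unique xs →
  2 * relatedPairs R xs + ∑ (λ x → relatedPairs R (xs ∖ x)) xs ≡ length xs * relatedPairs R xs
∑-relatedPairs-∖ R irrefl {xs} u = sym (begin
  length xs * P
    ≡⟨ ∑-const P xs ⟨
  ∑ (λ _ → P) xs
    ≡⟨ ∑-cong-∈ (relatedPairs-∖ R irrefl u) ⟩
  ∑ (λ x → count (R x) xs + count (λ y → R y x) xs + relatedPairs R (xs ∖ x)) xs
    ≡⟨ ∑-+ _ _ xs ⟩
  ∑ (λ x → count (R x) xs + count (λ y → R y x) xs) xs + Pᵢ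
    ≡⟨ cong (_+ Pᵢ) (∑-+ _ _ xs) ⟩
  P + ∑ (λ x → count (λ y → R y x) xs) xs + Pᵢ
    ≡⟨ cong (λ s → P + s + Pᵢ) (relatedPairs-transpose R xs) ⟩
  P + P + Pᵢ
    ≡⟨ cong (λ s → P + s + Pᵢ) (+-identityʳ P) ⟨
  2 * P + Pᵢ ∎)
  where
  P  = relatedPairs R xs
  Pᵢ = ∑ (λ x → relatedPairs R (xs ∖ x)) xs

∑-arrangements-inversionsBy : ∀ R → (∀ x → R x x ≡ false) → ∀ {xs} m → Unique xs → length xs ≡ m →
  2 * ∑ (inversionsBy R) (arrangements xs m) ≡ m ! * relatedPairs R xs
∑-arrangements-inversionsBy R irrefl {[]} zero    _ _   = refl
∑-arrangements-inversionsBy R irrefl {xs} (suc m) u len = begin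
  2 * ∑ (inversionsBy R) (arrangements xs (suc m))
    ≡⟨ cong (2 *_) (∑-arrangements-suc _ xs m) ⟩
  2 * ∑ (λ x → ∑ (λ w → count (R x) w + inversionsBy R w) (arrangements (xs ∖ x) m)) xs
    ≡⟨ ∑-*ˡ 2 _ xs ⟨
  ∑ (λ x → 2 * ∑ (λ w → count (R x) w + inversionsBy R w) (arrangements (xs ∖ x) m)) xs
    ≡⟨ ∑-cong-∈ first-letter ⟩
  ∑ (λ x → m ! * (2 * count (R x) xs + relatedPairs R (xs ∖ x))) xs
    ≡⟨ ∑-*ˡ (m !) _ xs ⟩
  m ! * ∑ (λ x → 2 * count (R x) xs + relatedPairs R (xs ∖ x)) xs
    ≡⟨ cong (m ! *_) (trans (∑-+ _ _ xs) (cong (_+ ∑ (λ x → relatedPairs R (xs ∖ x)) xs) (∑-*ˡ 2 (λ x → count (R x) xs) xs))) ⟩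
  m ! * (2 * relatedPairs R xs + ∑ (λ x → relatedPairs R (xs ∖ x)) xs)
    ≡⟨ cong (m ! *_) (trans (∑-relatedPairs-∖ R irrefl u) (cong (_* relatedPairs R xs) len)) ⟩
  m ! * (suc m * relatedPairs R xs)
    ≡⟨ *-assoc (m !) (suc m) _ ⟨
  m ! * suc m * relatedPairs R xs
    ≡⟨ cong (_* relatedPairs R xs) (*-comm (m !) (suc m)) ⟩
  suc m ! * relatedPairs R xs ∎
  where
  first-letter : ∀ {x} → x ∈ xs →
    2 * ∑ (λ w → count (R x) w + inversionsBy R w) (arrangements (xs ∖ x) m) ≡ m ! * (2 * count (R x) xs + relatedPairs R (xs ∖ x))
  first-letter {x} x∈xs = begin
    2 * ∑ (λ w → count (R x) w + inversionsBy R w) ws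
      ≡⟨ cong (2 *_) (∑-+ _ _ ws) ⟩
    2 * (∑ (count (R x)) ws + ∑ (inversionsBy R) ws)
      ≡⟨ *-distribˡ-+ 2 (∑ (count (R x)) ws) (∑ (inversionsBy R) ws) ⟩
    2 * ∑ (count (R x)) ws + 2 * ∑ (inversionsBy R) ws
      ≡⟨ cong₂ _+_ (cong (2 *_) (∑-arrangements-count (R x) m u′ len′)) (∑-arrangements-inversionsBy R irrefl m u′ len′) ⟩
    2 * (m ! * count (R x) (xs ∖ x)) + m ! * relatedPairs R (xs ∖ x)
      ≡⟨ cong (λ c → 2 * (m ! * c) + m ! * relatedPairs R (xs ∖ x)) (count-∖-reject (R x) (irrefl x) u x∈xs) ⟨
    2 * (m ! * count (R x) xs) + m ! * relatedPairs R (xs ∖ x)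
      ≡⟨ factor (m !) (count (R x) xs) (relatedPairs R (xs ∖ x)) ⟩
    m ! * (2 * count (R x) xs + relatedPairs R (xs ∖ x)) ∎
    where
    ws = arrangements (xs ∖ x) m
    u′ = Unique-∖ u
    len′ = length-∖ u x∈xs len
    factor : ∀ f a b → 2 * (f * a) + f * b ≡ f * (2 * a + b)
    factor = solve-∀

Unique-map-suc-upTo : ∀ n → Unique (map suc (upTo n))
Unique-map-suc-upTo n = Unique.map⁺ suc-injective (Unique.upTo⁺ n)

length-map-suc-upTo : ∀ n → length (map suc (upTo n)) ≡ n
length-map-suc-upTo n = trans (length-map suc (upTo n)) (length-upTo n)

∑-perms-const : ∀ k n → ∑ (λ _ → k) (perms n) ≡ n ! * k
∑-perms-const k n = ∑-arrangements-const k n (Unique-map-suc-upTo n) (length-map-suc-upTo n)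

∑-perms-inversionsBy : ∀ R → (∀ x → R x x ≡ false) → (∀ {x y} → x ≢ y → ⟦ R x y ⟧ + ⟦ R y x ⟧ ≡ 1) →
  ∀ n → 2 * ∑ (inversionsBy R) (perms n) ≡ n ! * (n C 2)
∑-perms-inversionsBy R irrefl tournament n = begin
  2 * ∑ (inversionsBy R) (perms n)         ≡⟨ ∑-arrangements-inversionsBy R irrefl n (Unique-map-suc-upTo n) (length-map-suc-upTo n) ⟩
  n ! * relatedPairs R (map suc (upTo n))  ≡⟨ cong (n ! *_) (relatedPairs-tournament R irrefl tournament (Unique-map-suc-upTo n)) ⟩
  n ! * (length (map suc (upTo n)) C 2)    ≡⟨ cong (λ k → n ! * (k C 2)) (length-map-suc-upTo n) ⟩
  n ! * (n C 2)                            ∎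

inv≡inversionsBy : ∀ π → inv π ≡ inversionsBy (λ x y → y <ᵇ x) π
inv≡inversionsBy []      = refl
inv≡inversionsBy (x ∷ π) = cong (count (λ y → y <ᵇ x) π +_) (inv≡inversionsBy π)

∑-perms-inv : ∀ n → 2 * ∑ inv (perms n) ≡ n ! * (n C 2)
∑-perms-inv n = trans (cong (2 *_) (∑-cong inv≡inversionsBy (perms n)))
                      (∑-perms-inversionsBy (λ x y → y <ᵇ x) <ᵇ-irrefl (λ x≢y → <ᵇ-tournament (x≢y ∘ sym)) n)

∑-perms-coinv : ∀ n → 2 * ∑ coinv (perms n) ≡ n ! * (n C 2)
∑-perms-coinv = ∑-perms-inversionsBy _<ᵇ_ <ᵇ-irrefl <ᵇ-tournament

-- Colorings

count-nonZeroᵇ-applyUpTo : ∀ (f : ℕ → ℕ) k → count nonZeroᵇ (applyUpTo (suc ∘ f) k) ≡ k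
count-nonZeroᵇ-applyUpTo f zero    = refl
count-nonZeroᵇ-applyUpTo f (suc k) = cong suc (count-nonZeroᵇ-applyUpTo (f ∘ suc) k)

∑-col-colorings : ∀ c′ n → 2 * ∑ col (words (upTo (suc c′)) n) ≡ n * c′ * suc c′ ^ n
∑-col-colorings c′ n = *-cancelˡ-≡ _ _ c (begin
  c * (2 * S)                       ≡⟨ *-left-comm c 2 S ⟩
  2 * (c * S)                       ≡⟨ cong (2 *_) (*-comm c S) ⟩
  2 * (S * c)                       ≡⟨ cong (2 *_) (subst (λ L → S * L ≡ n * sum (upTo c) * L ^ n) (length-upTo c) (∑-col-words (upTo c) n)) ⟩
  2 * (n * sum (upTo c) * c ^ n)    ≡⟨ cong (λ s → 2 * (n * s * c ^ n)) (sum-upTo c) ⟩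
  2 * (n * (c C 2) * c ^ n)         ≡⟨ regroup n (c C 2) (c ^ n) ⟩
  n * (2 * (c C 2)) * c ^ n         ≡⟨ cong (λ s → n * s * c ^ n) (2*[1+n]C2≡[1+n]*n c′) ⟩
  n * (c * c′) * c ^ n              ≡⟨ regroup′ c c′ n (c ^ n) ⟩
  c * (n * c′ * c ^ n)              ∎)
  where
  c = suc c′
  S = ∑ col (words (upTo c) n)
  regroup : ∀ n k p → 2 * (n * k * p) ≡ n * (2 * k) * p
  regroup = solve-∀
  regroup′ : ∀ c c′ n p → n * (c * c′) * p ≡ c * (n * c′ * p)
  regroup′ = solve-∀

∑-ascNZ-colorings : ∀ c′ π → suc c′ * ∑ (λ w → ascNZ (zip π w)) (words (upTo (suc c′)) (length π))
                              ≡ coinv π * c′ * suc c′ ^ length π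
∑-ascNZ-colorings c′ π = begin
  c * S                         ≡⟨ *-comm c S ⟩
  S * c                         ≡⟨ subst (λ L → S * L ≡ coinv π * N * L ^ length π) (length-upTo c) (∑-ascNZ-words (upTo c) π) ⟩
  coinv π * N * c ^ length π    ≡⟨ cong (λ k → coinv π * k * c ^ length π) (count-nonZeroᵇ-applyUpTo (λ i → i) c′) ⟩
  coinv π * c′ * c ^ length π   ∎
  where
  c = suc c′
  S = ∑ (λ w → ascNZ (zip π w)) (words (upTo c) (length π))
  N = count nonZeroᵇ (upTo c)

∑-invc-colorings : ∀ c′ {n} π → length π ≡ n →
  2 * ∑ (invc (suc c′) π) (words (upTo (suc c′)) n) ≡ suc c′ ^ n * (2 * inv π + n * c′ + c′ * (2 * coinv π))
∑-invc-colorings c′ π refl = begin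
  2 * ∑ (invc c π) W                       ≡⟨ cong (2 *_) linearity ⟩
  2 * (c ^ n * inv π + Sᶜ + c * Sᵃ)        ≡⟨ distrib (c ^ n * inv π) Sᶜ (c * Sᵃ) ⟩
  2 * (c ^ n * inv π) + 2 * Sᶜ + 2 * (c * Sᵃ)
    ≡⟨ cong₂ (λ u v → 2 * (c ^ n * inv π) + u + 2 * v) (∑-col-colorings c′ n) (∑-ascNZ-colorings c′ π) ⟩
  2 * (c ^ n * inv π) + n * c′ * c ^ n + 2 * (coinv π * c′ * c ^ n)
    ≡⟨ collect (c ^ n) (inv π) n c′ (coinv π) ⟩
  c ^ n * (2 * inv π + n * c′ + c′ * (2 * coinv π)) ∎
  where
  c = suc c′
  n = length π
  W = words (upTo c) n
  Sᶜ = ∑ col W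
  Sᵃ = ∑ (λ w → ascNZ (zip π w)) W
  linearity : ∑ (invc c π) W ≡ c ^ n * inv π + Sᶜ + c * Sᵃ
  linearity = begin
    ∑ (invc c π) W                                  ≡⟨ ∑-+ _ _ W ⟩
    ∑ (λ w → inv π + col w) W + ∑ (λ w → c * ascNZ (zip π w)) W
      ≡⟨ cong₂ _+_ (∑-+ _ _ W) (∑-*ˡ c _ W) ⟩
    ∑ (λ _ → inv π) W + Sᶜ + c * Sᵃ                 ≡⟨ cong (λ s → s + Sᶜ + c * Sᵃ) (∑-words-const (inv π) (upTo c) n) ⟩
    length (upTo c) ^ n * inv π + Sᶜ + c * Sᵃ       ≡⟨ cong (λ L → L ^ n * inv π + Sᶜ + c * Sᵃ) (length-upTo c) ⟩
    c ^ n * inv π + Sᶜ + c * Sᵃ                     ∎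
  distrib : ∀ a b d → 2 * (a + b + d) ≡ 2 * a + 2 * b + 2 * d
  distrib = solve-∀
  collect : ∀ p i n c′ a → 2 * (p * i) + n * c′ * p + 2 * (a * c′ * p) ≡ p * (2 * i + n * c′ + c′ * (2 * a))
  collect = solve-∀

-- The closed form and the recurrence

I-closed-form : ∀ c′ n → 2 * I (suc c′) n ≡ suc c′ ^ n * n ! * (suc c′ * (n C 2) + n * c′)
I-closed-form c′ n = begin
  2 * I c n
    ≡⟨ cong (2 *_) (∑-cartesianProduct _ (perms n) W) ⟩
  2 * ∑ (λ π → ∑ (invc c π) W) (perms n)
    ≡⟨ ∑-*ˡ 2 _ (perms n) ⟨
  ∑ (λ π → 2 * ∑ (invc c π) W) (perms n)
    ≡⟨ ∑-arrangements-cong _ n (∑-invc-colorings c′) ⟩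
  ∑ (λ π → c ^ n * (2 * inv π + n * c′ + c′ * (2 * coinv π))) (perms n)
    ≡⟨ ∑-*ˡ (c ^ n) _ (perms n) ⟩
  c ^ n * ∑ (λ π → 2 * inv π + n * c′ + c′ * (2 * coinv π)) (perms n)
    ≡⟨ cong (c ^ n *_) average ⟩
  c ^ n * (n ! * (n C 2) + n ! * (n * c′) + c′ * (n ! * (n C 2)))
    ≡⟨ collect c′ (c ^ n) (n !) (n C 2) n ⟩
  c ^ n * n ! * (c * (n C 2) + n * c′) ∎
  where
  c = suc c′
  W = words (upTo c) n
  average : ∑ (λ π → 2 * inv π + n * c′ + c′ * (2 * coinv π)) (perms n) ≡ n ! * (n C 2) + n ! * (n * c′) + c′ * (n ! * (n C 2))
  average = begin
    ∑ (λ π → 2 * inv π + n * c′ + c′ * (2 * coinv π)) (perms n)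
      ≡⟨ ∑-+ _ _ (perms n) ⟩
    ∑ (λ π → 2 * inv π + n * c′) (perms n) + ∑ (λ π → c′ * (2 * coinv π)) (perms n)
      ≡⟨ cong₂ _+_ (∑-+ _ _ (perms n)) (∑-*ˡ c′ _ (perms n)) ⟩
    ∑ (λ π → 2 * inv π) (perms n) + ∑ (λ _ → n * c′) (perms n) + c′ * ∑ (λ π → 2 * coinv π) (perms n)
      ≡⟨ cong₂ (λ u v → u + ∑ (λ _ → n * c′) (perms n) + c′ * v) (∑-*ˡ 2 inv (perms n)) (∑-*ˡ 2 coinv (perms n)) ⟩
    2 * ∑ inv (perms n) + ∑ (λ _ → n * c′) (perms n) + c′ * (2 * ∑ coinv (perms n))
      ≡⟨ cong₂ _+_ (cong₂ _+_ (∑-perms-inv n) (∑-perms-const (n * c′) n)) (cong (c′ *_) (∑-perms-coinv n)) ⟩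
    n ! * (n C 2) + n ! * (n * c′) + c′ * (n ! * (n C 2)) ∎
  collect : ∀ c′ p f k n → p * (f * k + f * (n * c′) + c′ * (f * k)) ≡ p * f * (suc c′ * k + n * c′)
  collect = solve-∀

I-one : ∀ c′ → I (suc c′) 1 ≡ suc c′ C 2
I-one c′ = *-cancelˡ-≡ _ _ 2 (begin
  2 * I (suc c′) 1                           ≡⟨ I-closed-form c′ 1 ⟩
  suc c′ ^ 1 * 1 ! * (suc c′ * 0 + 1 * c′)   ≡⟨ simplify c′ ⟩
  suc c′ * c′                                ≡⟨ 2*[1+n]C2≡[1+n]*n c′ ⟨
  2 * (suc c′ C 2)                           ∎)
  where
  simplify : ∀ d → suc d * 1 * (1 * 1) * (suc d * 0 + 1 * d) ≡ suc d * d
  simplify = solve-∀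

I-recurrence : ∀ c′ m → 2 * I (suc c′) (suc m) ≡ suc c′ ^ suc m * suc m ! * (suc c′ * suc m ∸ 1) + 2 * (suc c′ * suc m * I (suc c′) m)
I-recurrence c′ m = begin
  2 * I c n
    ≡⟨ I-closed-form c′ n ⟩
  c ^ n * n ! * (c * (n C 2) + n * c′)
    ≡⟨ cong (λ k → c ^ n * n ! * (c * k + n * c′)) ([1+n]C2≡n+nC2 m) ⟩
  c ^ n * n ! * (c * (m + m C 2) + n * c′)
    ≡⟨ split c′ m (c ^ m) (m !) (m C 2) ⟩
  c ^ n * n ! * (c * n ∸ 1) + c * n * (c ^ m * m ! * (c * (m C 2) + m * c′))
    ≡⟨ cong (λ z → c ^ n * n ! * (c * n ∸ 1) + c * n * z) (I-closed-form c′ m) ⟨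
  c ^ n * n ! * (c * n ∸ 1) + c * n * (2 * I c m)
    ≡⟨ cong (c ^ n * n ! * (c * n ∸ 1) +_) (*-left-comm (c * n) 2 (I c m)) ⟩
  c ^ n * n ! * (c * n ∸ 1) + 2 * (c * n * I c m) ∎
  where
  c = suc c′
  n = suc m
  -- suc c′ * suc m ∸ 1 computes to m + c′ * suc m.
  split : ∀ c′ m p f k → suc c′ * p * (suc m * f) * (suc c′ * (m + k) + suc m * c′)
                       ≡ suc c′ * p * (suc m * f) * (m + c′ * suc m) + suc c′ * suc m * (p * f * (suc c′ * k + m * c′))
  split = solve-∀

theorem3p7 : (c : ℕ) → c ≥ 1 →
    (I c 1 ≡ c C 2) ×
    ((n : ℕ) → n ≥ 2 →
      2 * I c n ≡ c ^ n * n ! * (c * n ∸ 1) + 2 * (c * n * I c (n ∸ 1)))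
theorem3p7 (suc c′) _ = I-one c′ , λ { (suc (suc m)) _ → I-recurrence c′ (suc m) ; (suc zero) (s≤s ()) }
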